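{- Let $\epsilon>0$. There is no online (robust/fully dynamic) asymptotic approximation scheme for bin packing which, for accuracy $\epsilon$ (i.e. achieving asymptotic approximation ratio $1+\epsilon$), uses a migration factor $\gamma\le \frac{1}{6}\left(\frac{1}{\epsilon}-11\right)$. In particular, migration factor $\Omega(1/\epsilon)$ is necessary for asymptotic approximation ratio $1+\epsilon$.
   Context: Bin packing: items $i$ have sizes $s(i)\in(0,1]$ and must be partitioned into bins of capacity $1$; $\mathrm{OPT}(J)$ is the minimum number of bins for item set $J$. In the online model with repacking, items arrive one at a time (in the fully dynamic model items may also depart); at time $t$ the algorithm maintains a packing of the current items and may repack previously packed items. The migration factor $\gamma$ means that at each time $t$ the total size of items whose bin changes is at most $\gamma\cdot s(i_t)$, where $i_t$ is the item arriving or departing at time $t$. An algorithm has asymptotic approximation ratio at most $\alpha$ if there is $f\in o(\mathrm{OPT})$ with $A(I(t))\le\alpha\,\mathrm{OPT}(I(t))+f(I(t))$ for all inputs and all times $t$, where $A(I(t))$ is the number of bins it uses at time $t$ and $I(t)$ the set of items present at time $t$.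
   Formalization: The accuracy ε ranges over the positive rationals and the migration factor γ over ℚ rather than the reals, while item sizes and the additive term f take rational values. -}

module Defs where

open import Data.Nat as ℕ using (ℕ; zero; suc)
import Data.Nat.Properties as ℕP
open import Data.Integer using (+_)
open import Data.Rational using (ℚ; 0ℚ; 1ℚ; _+_; _*_; _-_; _≤_; _<_; _/_; 1/_; >-nonZero)
open import Data.List using (List; []; _∷_; length; map; filter; upTo; deduplicate; lookup; _∷ʳ_; zip; foldr)
open import Data.List.Relation.Unary.All using (All)
open import Data.Product using (Σ; _×_; _,_; proj₁; proj₂)
open import Relation.Nullary using (¬_; Dec; yes; no)
open import Relation.Nullary.Decidable using (¬?)
open import Relation.Binary.PropositionalEquality using (_≡_)

ℕtoℚ : ℕ → ℚ
ℕtoℚ n = (+ n) / 1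

-- An input (robust model: insertions only) is the arrival sequence of item
-- sizes; item number i (0-based) is the i-th element.  Sizes lie in (0,1].
ValidSize : ℚ → Set
ValidSize s = (0ℚ < s) × (s ≤ 1ℚ)

ValidInput : List ℚ → Set
ValidInput σ = All ValidSize σ

-- A packing of the items of a list: item i goes into the bin labelled p i.
Packing : Set
Packing = ℕ → ℕ

indexed : List ℚ → List (ℕ × ℚ)
indexed σ = zip (upTo (length σ)) σ

sumℚ : List ℚ → ℚ
sumℚ = foldr _+_ 0ℚ

load : List ℚ → Packing → ℕ → ℚ
load σ p b = sumℚ (map proj₂ (filter (λ x → p (proj₁ x) ℕ.≟ b) (indexed σ)))

Feasible : List ℚ → Packing → Set
Feasible σ p = ∀ b → load σ p b ≤ 1ℚ

binsUsed : List ℚ → Packing → ℕ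
binsUsed σ p = length (deduplicate ℕ._≟_ (map p (upTo (length σ))))

IsOPT : List ℚ → ℕ → Set
IsOPT σ m =
  Σ Packing (λ p → Feasible σ p × (binsUsed σ p ≡ m))
  × (∀ p → Feasible σ p → m ℕ.≤ binsUsed σ p)

LittleOOPT : (List ℚ → ℚ) → Set
LittleOOPT f = ∀ (δ : ℚ) → 0ℚ < δ → Σ ℕ λ N →
  ∀ (J : List ℚ) (m : ℕ) → ValidInput J → IsOPT J m → N ℕ.≤ m →
  f J ≤ δ * ℕtoℚ m

migrated : List ℚ → Packing → Packing → ℚ
migrated σ p q = sumℚ (map proj₂ (filter (λ x → ¬? (p (proj₁ x) ℕ.≟ q (proj₁ x))) (indexed σ)))

-- A deterministic online algorithm with repacking: after the arrival of
-- the items σ (in this order) it maintains the packing A σ of them.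
-- Onlineness is built in: the packing at time t is a function of the
-- prefix of the input that has arrived so far.
OnlineAlgorithm : Set
OnlineAlgorithm = List ℚ → Packing

GoodAlgorithm : ℚ → ℚ → OnlineAlgorithm → (List ℚ → ℚ) → Set
GoodAlgorithm α γ A f =
  (∀ σ → ValidInput σ → Feasible σ (A σ))
  × (∀ σ m → ValidInput σ → IsOPT σ m →
       ℕtoℚ (binsUsed σ (A σ)) ≤ α * ℕtoℚ m + f σ)
  × (∀ σ s → ValidInput σ → ValidSize s →
       migrated σ (A σ) (A (σ ∷ʳ s)) ≤ γ * s)

migrationBound : (ε : ℚ) → 0ℚ < ε → ℚ
migrationBound ε ε>0 = ((+ 1) / 6) * ((1/ ε) {{>-nonZero ε>0}} - (+ 11) / 1)

-- Fix t and write D = 16 + 10t.  The adversary first sends 2M large items of size (6+5t)/D;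
-- three never fit in a bin, so OPT = M.  It then sends 2M(2+t) small items of size 5/D, after
-- which OPT = 2M, each optimal bin holding one large and 2+t small items and being exactly full.
-- If 5γ < 6+5t, no arrival of a small item pays for moving a large one, so the large items stay
-- where the algorithm put them in the first phase.  Let C be the number of large items then
-- sharing a bin with another large item.  Weighting items by 1 − [paired]/2 shows that the first
-- packing uses at least 2M − C/2 bins; weighting them by size + η·[paired] with η = 2/D shows
-- that the final packing uses at least 2M + ηC bins, since a bin holding a pair has no room for
-- anything else and 2·(6+5t)/D + 2η = 1.  The two ratio bounds together eliminate C and give
-- η ≤ (ε + δ)(1 + η), i.e. (ε + δ)(9+5t) ≥ 1.  The assumed bound on γ leaves room to choose t
-- with 5γ < 6+5t and ε(9+5t) < 1, and δ is taken so small that this is contradicted.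

module Submission where

open import Defs
open import Data.Nat as ℕ using (ℕ; zero; suc; z≤n; s≤s)
import Data.Nat.Properties as ℕP
open import Data.Nat.Solver using (module +-*-Solver)
open import Data.Nat.DivMod using (m≡m%n+[m/n]*n; m%n<n; m/n*n≤m; m<n*o⇒m/o<n)
import Data.Integer.Properties as ℤP
import Data.Integer.Solver
open import Data.Integer as ℤ using (+_; -[1+_])
open import Data.Rational
open import Data.Rational.Properties
import Data.Rational.Unnormalised as ℚᵘ
import Data.Rational.Unnormalised.Properties as ℚᵘP
open import Data.Rational.Solver renaming (module +-*-Solver to ℚ-Solver)
open import Data.List using (List; []; _∷_; _++_; length; map; filter; deduplicate; upTo; zip; _∷ʳ_)
import Data.List.Properties as ListP
open import Data.List.Relation.Unary.All as All using (All; []; _∷_)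
import Data.List.Relation.Unary.All.Properties as AllP
open import Data.List.Relation.Unary.Any using (Any; here; there; any?)
open import Data.List.Relation.Unary.AllPairs using ([]; _∷_)
open import Data.List.Relation.Unary.Unique.Propositional using (Unique)
import Data.List.Relation.Unary.Unique.Propositional.Properties as UniqueP
open import Data.List.Relation.Unary.Unique.DecPropositional.Properties ℕ._≟_ using (deduplicate-!)
open import Data.List.Membership.Propositional using (_∈_; find; lose)
open import Data.List.Membership.Propositional.Properties
  using (∈-map⁺; ∈-map⁻; ∈-filter⁻; ∈-filter⁺; ∈-deduplicate⁺; ∈-deduplicate⁻; ∈-upTo⁻; ∈-upTo⁺)
open import Data.Product using (Σ; _×_; _,_; proj₁; proj₂; ∃)
open import Function using (_∘_)
open import Level using (Level)
open import Relation.Nullary.Decidable using (¬?; _×-dec_; from-yes; dec-true; dec-false)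
open import Relation.Unary using (Pred; Decidable)
open import Relation.Unary.Properties using (∁?)
open import Data.Sum using (_⊎_; inj₁; inj₂)
open import Data.Empty using (⊥; ⊥-elim)
open import Relation.Binary.PropositionalEquality
open import Relation.Nullary using (¬_; yes; no; Dec; does)
open import Data.Bool using (true; false; if_then_else_)

ℕtoℚ-toℚᵘ : ∀ n → toℚᵘ (ℕtoℚ n) ℚᵘ.≃ ℚᵘ.mkℚᵘ (+ n) 0
ℕtoℚ-toℚᵘ n = toℚᵘ-fromℚᵘ (ℚᵘ.mkℚᵘ (+ n) 0)

ℕtoℚ-suc : ∀ n → ℕtoℚ (suc n) ≡ 1ℚ + ℕtoℚ n
ℕtoℚ-suc n = toℚᵘ-injective (begin-equality
  toℚᵘ (ℕtoℚ (suc n))                      ≃⟨ ℕtoℚ-toℚᵘ (suc n) ⟩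
  ℚᵘ.mkℚᵘ (+ suc n) 0                       ≃⟨ ℚᵘ.*≡* (ℤ-solve (+ n)) ⟩
  ℚᵘ.mkℚᵘ (+ 1) 0 ℚᵘ.+ ℚᵘ.mkℚᵘ (+ n) 0     ≃⟨ ℚᵘP.+-cong (ℕtoℚ-toℚᵘ 1) (ℕtoℚ-toℚᵘ n) ⟨
  toℚᵘ 1ℚ ℚᵘ.+ toℚᵘ (ℕtoℚ n)              ≃⟨ toℚᵘ-homo-+ 1ℚ (ℕtoℚ n) ⟨
  toℚᵘ (1ℚ + ℕtoℚ n)                       ∎)
  where
  open ℚᵘP.≤-Reasoning
  ℤ-solve : ∀ x → (+ 1 ℤ.+ x) ℤ.* + 1 ≡ (+ 1 ℤ.* + 1 ℤ.+ x ℤ.* + 1) ℤ.* (+ 1 ℤ.* + 1)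
  ℤ-solve = solve 1 (λ x → (con (+ 1) :+ x) :* con (+ 1) := (con (+ 1) :* con (+ 1) :+ x :* con (+ 1)) :* (con (+ 1) :* con (+ 1))) refl
    where open Data.Integer.Solver.+-*-Solver

ℕtoℚ-+ : ∀ m n → ℕtoℚ (m ℕ.+ n) ≡ ℕtoℚ m + ℕtoℚ n
ℕtoℚ-+ zero    n = sym (+-identityˡ (ℕtoℚ n))
ℕtoℚ-+ (suc m) n = begin
  ℕtoℚ (suc (m ℕ.+ n))          ≡⟨ ℕtoℚ-suc (m ℕ.+ n) ⟩
  1ℚ + ℕtoℚ (m ℕ.+ n)           ≡⟨ cong (_+_ 1ℚ) (ℕtoℚ-+ m n) ⟩
  1ℚ + (ℕtoℚ m + ℕtoℚ n)        ≡⟨ +-assoc 1ℚ (ℕtoℚ m) (ℕtoℚ n) ⟨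
  (1ℚ + ℕtoℚ m) + ℕtoℚ n        ≡⟨ cong (_+ ℕtoℚ n) (ℕtoℚ-suc m) ⟨
  ℕtoℚ (suc m) + ℕtoℚ n         ∎
  where open ≡-Reasoning

ℕtoℚ-* : ∀ m n → ℕtoℚ (m ℕ.* n) ≡ ℕtoℚ m * ℕtoℚ n
ℕtoℚ-* zero    n = sym (*-zeroˡ (ℕtoℚ n))
ℕtoℚ-* (suc m) n = begin
  ℕtoℚ (n ℕ.+ m ℕ.* n)          ≡⟨ ℕtoℚ-+ n (m ℕ.* n) ⟩
  ℕtoℚ n + ℕtoℚ (m ℕ.* n)       ≡⟨ cong (_+_ (ℕtoℚ n)) (ℕtoℚ-* m n) ⟩
  ℕtoℚ n + ℕtoℚ m * ℕtoℚ n      ≡⟨ solve 2 (λ x y → y :+ x :* y := (con 1ℚ :+ x) :* y) refl (ℕtoℚ m) (ℕtoℚ n) ⟩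
  (1ℚ + ℕtoℚ m) * ℕtoℚ n        ≡⟨ cong (_* ℕtoℚ n) (ℕtoℚ-suc m) ⟨
  ℕtoℚ (suc m) * ℕtoℚ n         ∎
  where
  open ≡-Reasoning
  open ℚ-Solver

ℕtoℚ-mono-≤ : ∀ {m n} → m ℕ.≤ n → ℕtoℚ m ≤ ℕtoℚ n
ℕtoℚ-mono-≤ {m} {n} m≤n = toℚᵘ-cancel-≤
  (ℚᵘP.≤-respˡ-≃ (ℚᵘP.≃-sym (ℕtoℚ-toℚᵘ m)) (ℚᵘP.≤-respʳ-≃ (ℚᵘP.≃-sym (ℕtoℚ-toℚᵘ n))
    (ℚᵘ.*≤* (subst₂ ℤ._≤_ (sym (ℤP.*-identityʳ (+ m))) (sym (ℤP.*-identityʳ (+ n))) (ℤ.+≤+ m≤n)))))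

ℕtoℚ-mono-< : ∀ {m n} → m ℕ.< n → ℕtoℚ m < ℕtoℚ n
ℕtoℚ-mono-< {m} {n} m<n = toℚᵘ-cancel-<
  (ℚᵘP.<-respˡ-≃ (ℚᵘP.≃-sym (ℕtoℚ-toℚᵘ m)) (ℚᵘP.<-respʳ-≃ (ℚᵘP.≃-sym (ℕtoℚ-toℚᵘ n))
    (ℚᵘ.*<* (subst₂ ℤ._<_ (sym (ℤP.*-identityʳ (+ m))) (sym (ℤP.*-identityʳ (+ n))) (ℤ.+<+ m<n)))))

ℕtoℚ-nonNeg : ∀ n → 0ℚ ≤ ℕtoℚ n
ℕtoℚ-nonNeg n = ℕtoℚ-mono-≤ {0} {n} z≤n

ℕtoℚ-cancel-≤ : ∀ {m n} → ℕtoℚ m ≤ ℕtoℚ n → m ℕ.≤ n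
ℕtoℚ-cancel-≤ {m} {n} h with ℕP.≤-<-connex m n
... | inj₁ m≤n = m≤n
... | inj₂ n<m = ⊥-elim (<-irrefl refl (<-≤-trans (ℕtoℚ-mono-< n<m) h))

cross<⇒<ℕtoℚ : ∀ {q} n → ↥ q ℤ.* + 1 ℤ.< + n ℤ.* ↧ q → q < ℕtoℚ n
cross<⇒<ℕtoℚ {q@record{}} n lt = toℚᵘ-cancel-< (ℚᵘP.<-respʳ-≃ (ℚᵘP.≃-sym (ℕtoℚ-toℚᵘ n)) (ℚᵘ.*<* lt))

ℕtoℚ-unbounded : ∀ q → ∃ λ n → q < ℕtoℚ n
ℕtoℚ-unbounded (mkℚ -[1+ m ]    d _) = 0 , cross<⇒<ℕtoℚ 0 ℤ.-<+
ℕtoℚ-unbounded (mkℚ (+ zero)    d _) = 1 , cross<⇒<ℕtoℚ 1 (ℤ.+<+ (s≤s z≤n))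
ℕtoℚ-unbounded (mkℚ (+ (suc m)) d _) = suc (suc m) , cross<⇒<ℕtoℚ (suc (suc m)) (ℤ.+<+ (begin-strict
  suc m ℕ.* 1              ≡⟨ ℕP.*-identityʳ (suc m) ⟩
  suc m                    <⟨ ℕP.n<1+n (suc m) ⟩
  suc (suc m)              ≤⟨ ℕP.m≤m*n (suc (suc m)) (suc d) ⟩
  suc (suc m) ℕ.* suc d    ∎))
  where open ℕP.≤-Reasoning

p≤q⇒0≤q-p : ∀ {p q} → p ≤ q → 0ℚ ≤ q - p
p≤q⇒0≤q-p {p} {q} p≤q = subst (_≤ q - p) (+-inverseʳ p) (+-monoˡ-≤ (- p) p≤q)

p<q⇒0<q-p : ∀ {p q} → p < q → 0ℚ < q - p
p<q⇒0<q-p {p} {q} p<q = subst (_< q - p) (+-inverseʳ p) (+-monoˡ-< (- p) p<q)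

0<q-p⇒p<q : ∀ {p q} → 0ℚ < q - p → p < q
0<q-p⇒p<q {p} {q} h = subst₂ _<_ (+-identityʳ p) (solve 2 (λ p q → p :+ (q :- p) := q) refl p q) (+-monoʳ-< p h)
  where open ℚ-Solver

0≤q-p⇒p≤q : ∀ {p q} → 0ℚ ≤ q - p → p ≤ q
0≤q-p⇒p≤q {p} {q} h = subst₂ _≤_ (+-identityʳ p) (solve 2 (λ p q → p :+ (q :- p) := q) refl p q) (+-monoʳ-≤ p h)
  where open ℚ-Solver

*-nonNeg : ∀ {p q} → 0ℚ ≤ p → 0ℚ ≤ q → 0ℚ ≤ p * q
*-nonNeg {p} {q} p≥0 q≥0 = subst (_≤ p * q) (*-zeroˡ q) (*-monoʳ-≤-nonNeg q {{nonNegative q≥0}} p≥0)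

*-pos : ∀ {p q} → 0ℚ < p → 0ℚ < q → 0ℚ < p * q
*-pos {p} {q} p>0 q>0 = subst (_< p * q) (*-zeroˡ q) (*-monoˡ-<-pos q {{positive q>0}} p>0)

private variable
  a ℓ : Level
  A : Set a

∑ : (A → ℚ) → List A → ℚ
∑ f xs = sumℚ (map f xs)

∑-++ : ∀ (f : A → ℚ) xs ys → ∑ f (xs ++ ys) ≡ ∑ f xs + ∑ f ys
∑-++ f []       ys = sym (+-identityˡ _)
∑-++ f (x ∷ xs) ys = trans (cong (_+_ (f x)) (∑-++ f xs ys)) (sym (+-assoc (f x) _ _))

∑-partition : ∀ {P : Pred A ℓ} (P? : Decidable P) (f : A → ℚ) xs →
              ∑ f xs ≡ ∑ f (filter P? xs) + ∑ f (filter (∁? P?) xs)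
∑-partition P? f []       = refl
∑-partition P? f (x ∷ xs) with P? x
... | yes _ = trans (cong (_+_ (f x)) (∑-partition P? f xs)) (sym (+-assoc (f x) _ _))
... | no  _ = trans (cong (_+_ (f x)) (∑-partition P? f xs))
                (solve 3 (λ a b c → a :+ (b :+ c) := b :+ (a :+ c)) refl (f x) (∑ f (filter P? xs)) (∑ f (filter (∁? P?) xs)))
  where open ℚ-Solver

∑-mono : ∀ {f g : A → ℚ} {xs} → All (λ x → f x ≤ g x) xs → ∑ f xs ≤ ∑ g xs
∑-mono []       = ≤-refl
∑-mono (h ∷ hs) = +-mono-≤ h (∑-mono hs)

∑-cong : ∀ {f g : A → ℚ} {xs} → All (λ x → f x ≡ g x) xs → ∑ f xs ≡ ∑ g xs
∑-cong []       = refl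
∑-cong (h ∷ hs) = cong₂ _+_ h (∑-cong hs)

∑-nonNeg : ∀ {f : A → ℚ} {xs} → All (λ x → 0ℚ ≤ f x) xs → 0ℚ ≤ ∑ f xs
∑-nonNeg []       = ≤-refl
∑-nonNeg (h ∷ hs) = +-mono-≤ h (∑-nonNeg hs)

∑-const : ∀ {f : A → ℚ} {c xs} → All (λ x → f x ≡ c) xs → ∑ f xs ≡ c * ℕtoℚ (length xs)
∑-const {c = c} []                  = sym (*-zeroʳ c)
∑-const {f = f} {c} {x ∷ xs} (h ∷ hs) = begin
  f x + ∑ f xs                   ≡⟨ cong₂ _+_ h (∑-const hs) ⟩
  c + c * ℕtoℚ (length xs)       ≡⟨ solve 2 (λ c n → c :+ c :* n := c :* (con 1ℚ :+ n)) refl c (ℕtoℚ (length xs)) ⟩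
  c * (1ℚ + ℕtoℚ (length xs))    ≡⟨ cong (_*_ c) (ℕtoℚ-suc (length xs)) ⟨
  c * ℕtoℚ (suc (length xs))     ∎
  where
  open ≡-Reasoning
  open ℚ-Solver

∑-+ : ∀ (f g : A → ℚ) xs → ∑ (λ x → f x + g x) xs ≡ ∑ f xs + ∑ g xs
∑-+ f g []       = refl
∑-+ f g (x ∷ xs) = trans (cong (_+_ (f x + g x)) (∑-+ f g xs))
  (solve 4 (λ a b c d → (a :+ b) :+ (c :+ d) := (a :+ c) :+ (b :+ d)) refl (f x) (g x) (∑ f xs) (∑ g xs))
  where open ℚ-Solver

∑-linear : ∀ (f g : A → ℚ) c xs → ∑ (λ x → f x + c * g x) xs ≡ ∑ f xs + c * ∑ g xs
∑-linear f g c []       = sym (cong (_+_ 0ℚ) (*-zeroʳ c))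
∑-linear f g c (x ∷ xs) = trans (cong (_+_ (f x + c * g x)) (∑-linear f g c xs))
  (solve 5 (λ a b c d e → (a :+ c :* b) :+ (d :+ c :* e) := (a :+ d) :+ c :* (b :+ e)) refl (f x) (g x) c (∑ f xs) (∑ g xs))
  where open ℚ-Solver

∑-∈ : ∀ {f : A → ℚ} {x xs} → x ∈ xs → All (λ y → 0ℚ ≤ f y) xs → f x ≤ ∑ f xs
∑-∈ {f = f} {xs = y ∷ xs} (here refl) (_ ∷ hs) =
  subst (_≤ f y + ∑ f xs) (+-identityʳ (f y)) (+-monoʳ-≤ (f y) (∑-nonNeg hs))
∑-∈ {f = f} {x} {y ∷ xs} (there x∈) (h ∷ hs) =
  subst (_≤ f y + ∑ f xs) (+-identityˡ (f x)) (+-mono-≤ h (∑-∈ x∈ hs))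

∑-empty : ∀ {f : A → ℚ} xs → (∀ {x} → ¬ x ∈ xs) → ∑ f xs ≡ 0ℚ
∑-empty []       _    = refl
∑-empty (x ∷ xs) ∉xs = ⊥-elim (∉xs (here refl))

∑-upTo-suc : ∀ (f : ℕ → ℚ) n → ∑ f (upTo (suc n)) ≡ ∑ f (upTo n) + f n
∑-upTo-suc f n = begin
  ∑ f (upTo (suc n))               ≡⟨ cong (∑ f) (ListP.upTo-∷ʳ n) ⟨
  ∑ f (upTo n ++ n ∷ [])           ≡⟨ ∑-++ f (upTo n) (n ∷ []) ⟩
  ∑ f (upTo n) + (f n + 0ℚ)        ≡⟨ cong (_+_ (∑ f (upTo n))) (+-identityʳ (f n)) ⟩
  ∑ f (upTo n) + f n               ∎
  where open ≡-Reasoning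

∑-upTo-vanishing : ∀ (f : ℕ → ℚ) m → (∀ r → f (m ℕ.+ r) ≡ 0ℚ) → ∀ r → ∑ f (upTo (m ℕ.+ r)) ≡ ∑ f (upTo (m ℕ.+ 0))
∑-upTo-vanishing f m f≡0 zero    = refl
∑-upTo-vanishing f m f≡0 (suc r) = begin
  ∑ f (upTo (m ℕ.+ suc r))              ≡⟨ cong (∑ f ∘ upTo) (ℕP.+-suc m r) ⟩
  ∑ f (upTo (suc (m ℕ.+ r)))            ≡⟨ ∑-upTo-suc f (m ℕ.+ r) ⟩
  ∑ f (upTo (m ℕ.+ r)) + f (m ℕ.+ r)    ≡⟨ cong₂ _+_ (∑-upTo-vanishing f m f≡0 r) (f≡0 r) ⟩
  ∑ f (upTo (m ℕ.+ 0)) + 0ℚ             ≡⟨ +-identityʳ _ ⟩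
  ∑ f (upTo (m ℕ.+ 0))                  ∎
  where open ≡-Reasoning

indicator : ∀ {P : Set ℓ} → Dec P → ℚ
indicator (yes _) = 1ℚ
indicator (no  _) = 0ℚ

indicator-yes : ∀ {P : Set ℓ} (P? : Dec P) → P → indicator P? ≡ 1ℚ
indicator-yes (yes _) _  = refl
indicator-yes (no ¬p) p  = ⊥-elim (¬p p)

indicator-no : ∀ {P : Set ℓ} (P? : Dec P) → ¬ P → indicator P? ≡ 0ℚ
indicator-no (yes p) ¬p = ⊥-elim (¬p p)
indicator-no (no  _) _  = refl

filter-map : ∀ {B : Set} {P : Pred B ℓ} (P? : Decidable P) (h : A → B) xs →
             filter P? (map h xs) ≡ map h (filter (P? ∘ h) xs)
filter-map P? h []       = refl
filter-map P? h (x ∷ xs) with P? (h x)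
... | yes _ = cong (h x ∷_) (filter-map P? h xs)
... | no  _ = filter-map P? h xs

zip-map-self : ∀ {B : Set} (g : A → B) xs → zip xs (map g xs) ≡ map (λ x → x , g x) xs
zip-map-self g []       = refl
zip-map-self g (x ∷ xs) = cong ((x , g x) ∷_) (zip-map-self g xs)

length-filter-∁ : ∀ {P : Pred A ℓ} (P? : Decidable P) xs →
                  length xs ≡ length (filter P? xs) ℕ.+ length (filter (∁? P?) xs)
length-filter-∁ P? []       = refl
length-filter-∁ P? (x ∷ xs) with P? x
... | yes _ = cong suc (length-filter-∁ P? xs)
... | no  _ = trans (cong suc (length-filter-∁ P? xs)) (sym (ℕP.+-suc _ _))

Unique∧All≡⇒length≤1 : ∀ {v : A} {xs} → Unique xs → All (_≡ v) xs → length xs ℕ.≤ 1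
Unique∧All≡⇒length≤1 {xs = []}         _                 _                  = z≤n
Unique∧All≡⇒length≤1 {xs = _ ∷ []}     _                 _                  = s≤s z≤n
Unique∧All≡⇒length≤1 {xs = _ ∷ _ ∷ _} ((x≢y ∷ _) ∷ _) (refl ∷ refl ∷ _) = ⊥-elim (x≢y refl)

∈∧∈∧≢⇒2≤length : ∀ {x y : A} {xs} → x ∈ xs → y ∈ xs → x ≢ y → 2 ℕ.≤ length xs
∈∧∈∧≢⇒2≤length (here refl) (here refl) x≢y = ⊥-elim (x≢y refl)
∈∧∈∧≢⇒2≤length {xs = _ ∷ _ ∷ _} (here refl) (there _) _ = s≤s (s≤s z≤n)
∈∧∈∧≢⇒2≤length {xs = _ ∷ _ ∷ _} (there _) (here refl) _ = s≤s (s≤s z≤n)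
∈∧∈∧≢⇒2≤length (there x∈) (there y∈) x≢y = ℕP.m≤n⇒m≤1+n (∈∧∈∧≢⇒2≤length x∈ y∈ x≢y)

Unique∧interval⇒length≤ : ∀ c lo xs → Unique xs → All (λ i → lo ℕ.≤ i × i ℕ.< lo ℕ.+ c) xs → length xs ℕ.≤ c
Unique∧interval⇒length≤ zero    lo []      _ _ = z≤n
Unique∧interval⇒length≤ zero    lo (_ ∷ _) _ ((lo≤i , i<lo+0) ∷ _) =
  ⊥-elim (ℕP.<-irrefl refl (ℕP.<-≤-trans i<lo+0 (subst (ℕ._≤ _) (sym (ℕP.+-identityʳ lo)) lo≤i)))
Unique∧interval⇒length≤ (suc c) lo xs u bounds = begin
  length xs                                  ≡⟨ length-filter-∁ (ℕ._≟ top) xs ⟩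
  length (filter (ℕ._≟ top) xs) ℕ.+ length rest
    ≤⟨ ℕP.+-mono-≤ (Unique∧All≡⇒length≤1 (UniqueP.filter⁺ (ℕ._≟ top) u) (AllP.all-filter (ℕ._≟ top) xs))
                   (Unique∧interval⇒length≤ c lo rest (UniqueP.filter⁺ (∁? (ℕ._≟ top)) u) (All.tabulate below-top)) ⟩
  suc c                                      ∎
  where
  open ℕP.≤-Reasoning
  top = lo ℕ.+ c
  rest = filter (∁? (ℕ._≟ top)) xs
  below-top : ∀ {i} → i ∈ rest → lo ℕ.≤ i × i ℕ.< lo ℕ.+ c
  below-top {i} i∈ with ∈-filter⁻ (∁? (ℕ._≟ top)) {xs = xs} i∈
  ... | i∈xs , i≢top with All.lookup bounds i∈xs
  ...   | lo≤i , i<lo+1+c = lo≤i , ℕP.≤∧≢⇒< (ℕP.≤-pred (subst (i ℕ.<_) (ℕP.+-suc lo c) i<lo+1+c)) i≢top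

All<-filter-upTo : ∀ {P : Pred ℕ ℓ} (P? : Decidable P) n → All (ℕ._< n) (filter P? (upTo n))
All<-filter-upTo P? n = All.tabulate (λ i∈ → ∈-upTo⁻ (proj₁ (∈-filter⁻ P? {xs = upTo n} i∈)))

Unique-filter-upTo : ∀ {P : Pred ℕ ℓ} (P? : Decidable P) n → Unique (filter P? (upTo n))
Unique-filter-upTo P? n = UniqueP.filter⁺ P? (UniqueP.upTo⁺ n)

m+d≡n⇒m≤n : ∀ m d {n} → m ℕ.+ d ≡ n → m ℕ.≤ n
m+d≡n⇒m≤n m d refl = ℕP.m≤m+n m d

div-interval : ∀ m n .{{_ : ℕ.NonZero n}} → m ℕ./ n ℕ.* n ℕ.≤ m × m ℕ.< m ℕ./ n ℕ.* n ℕ.+ n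
div-interval m n = m/n*n≤m m n , (begin-strict
  m                            ≡⟨ m≡m%n+[m/n]*n m n ⟩
  m ℕ.% n ℕ.+ m ℕ./ n ℕ.* n    <⟨ ℕP.+-monoˡ-< (m ℕ./ n ℕ.* n) (m%n<n m n) ⟩
  n ℕ.+ m ℕ./ n ℕ.* n          ≡⟨ ℕP.+-comm n (m ℕ./ n ℕ.* n) ⟩
  m ℕ./ n ℕ.* n ℕ.+ n          ∎)
  where open ℕP.≤-Reasoning

-- Counting bins by weights

pointMass : ℕ → ℚ → ℕ → ℚ
pointMass c v b with c ℕ.≟ b
... | yes _ = v
... | no  _ = 0ℚ

∑-pointMass-∉ : ∀ {c} v bs → ¬ c ∈ bs → ∑ (pointMass c v) bs ≡ 0ℚ
∑-pointMass-∉     v []       _    = refl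
∑-pointMass-∉ {c} v (b ∷ bs) c∉ with c ℕ.≟ b
... | yes c≡b = ⊥-elim (c∉ (here c≡b))
... | no  _   = trans (+-identityˡ _) (∑-pointMass-∉ v bs (c∉ ∘ there))

∑-pointMass : ∀ {c} v bs → Unique bs → c ∈ bs → ∑ (pointMass c v) bs ≡ v
∑-pointMass {c} v (b ∷ bs) (b∉bs ∷ u) c∈ with c ℕ.≟ b | c∈
... | yes refl | _          = trans (cong (_+_ v) (∑-pointMass-∉ v bs (λ c∈bs → All.lookup b∉bs c∈bs refl))) (+-identityʳ v)
... | no  c≢b  | here c≡b   = ⊥-elim (c≢b c≡b)
... | no  _    | there c∈bs = trans (+-identityˡ _) (∑-pointMass v bs u c∈bs)

module _ (p : A → ℕ) (w : A → ℚ) where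

  binWeight : List A → ℕ → ℚ
  binWeight xs b = ∑ w (filter (λ x → p x ℕ.≟ b) xs)

  binWeight-∷ : ∀ x xs b → binWeight (x ∷ xs) b ≡ pointMass (p x) (w x) b + binWeight xs b
  binWeight-∷ x xs b with p x ℕ.≟ b
  ... | yes px≡b = cong (∑ w) (ListP.filter-accept (λ x → p x ℕ.≟ b) px≡b)
  ... | no  px≢b = trans (cong (∑ w) (ListP.filter-reject (λ x → p x ℕ.≟ b) px≢b)) (sym (+-identityˡ _))

  ∑-by-bins : ∀ bs xs → Unique bs → All (λ x → p x ∈ bs) xs → ∑ w xs ≡ ∑ (binWeight xs) bs
  ∑-by-bins bs []       _ _ =
    sym (trans (∑-const {f = binWeight []} {0ℚ} {bs} (All.tabulate (λ _ → refl))) (*-zeroˡ (ℕtoℚ (length bs))))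
  ∑-by-bins bs (x ∷ xs) u (x∈ ∷ xs∈) = begin
    w x + ∑ w xs                                                   ≡⟨ cong (_+_ (w x)) (∑-by-bins bs xs u xs∈) ⟩
    w x + ∑ (binWeight xs) bs                                      ≡⟨ cong (_+ ∑ (binWeight xs) bs) (∑-pointMass (w x) bs u x∈) ⟨
    ∑ (pointMass (p x) (w x)) bs + ∑ (binWeight xs) bs             ≡⟨ ∑-+ (pointMass (p x) (w x)) (binWeight xs) bs ⟨
    ∑ (λ b → pointMass (p x) (w x) b + binWeight xs b) bs          ≡⟨ ∑-cong {xs = bs} (All.tabulate (λ {b} _ → binWeight-∷ x xs b)) ⟨
    ∑ (binWeight (x ∷ xs)) bs                                      ∎
    where open ≡-Reasoning

  ∑-≤-numberOfBins : ∀ xs → (∀ b → binWeight xs b ≤ 1ℚ) →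
                     ∑ w xs ≤ ℕtoℚ (length (deduplicate ℕ._≟_ (map p xs)))
  ∑-≤-numberOfBins xs ≤1 = begin
    ∑ w xs                        ≡⟨ ∑-by-bins bins xs (deduplicate-! (map p xs)) (All.tabulate (∈-deduplicate⁺ ℕ._≟_ ∘ ∈-map⁺ p)) ⟩
    ∑ (binWeight xs) bins         ≤⟨ ∑-mono {xs = bins} (All.tabulate (λ {b} _ → ≤1 b)) ⟩
    ∑ (λ _ → 1ℚ) bins             ≡⟨ ∑-const {xs = bins} (All.tabulate (λ _ → refl)) ⟩
    1ℚ * ℕtoℚ (length bins)       ≡⟨ *-identityˡ _ ⟩
    ℕtoℚ (length bins)            ∎
    where
    open ≤-Reasoning
    bins = deduplicate ℕ._≟_ (map p xs)

isOPT : ∀ σ m p → Feasible σ p → binsUsed σ p ℕ.≤ m → (∀ q → Feasible σ q → m ℕ.≤ binsUsed σ q) → IsOPT σ m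
isOPT σ m p feasible ≤m m≤ = (p , feasible , ℕP.≤-antisym ≤m (m≤ p feasible)) , m≤

Competitive : ℚ → ℕ → OnlineAlgorithm → Set
Competitive ρ N A = ∀ σ m → ValidInput σ → IsOPT σ m → N ℕ.≤ m → ℕtoℚ (binsUsed σ (A σ)) ≤ ρ * ℕtoℚ m

asymptotic⇒competitive : ∀ {α δ} {A : OnlineAlgorithm} {f : List ℚ → ℚ} {N} →
  (∀ σ m → ValidInput σ → IsOPT σ m → ℕtoℚ (binsUsed σ (A σ)) ≤ α * ℕtoℚ m + f σ) →
  (∀ σ m → ValidInput σ → IsOPT σ m → N ℕ.≤ m → f σ ≤ δ * ℕtoℚ m) →
  Competitive (α + δ) N A
asymptotic⇒competitive {α} {δ} ratio f≤δOPT σ m valid opt N≤m =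
  ≤-trans (ratio σ m valid opt)
    (≤-trans (+-monoʳ-≤ (α * ℕtoℚ m) (f≤δOPT σ m valid opt N≤m)) (≤-reflexive (sym (*-distribʳ-+ (ℕtoℚ m) α δ))))

migration-nonNeg : ∀ {A : OnlineAlgorithm} {γ} →
  (∀ σ s → ValidInput σ → ValidSize s → migrated σ (A σ) (A (σ ∷ʳ s)) ≤ γ * s) → 0ℚ ≤ γ
migration-nonNeg {γ = γ} migration =
  subst (0ℚ ≤_) (*-identityʳ γ) (migration [] 1ℚ [] (*<* (ℤ.+<+ (s≤s z≤n)) , ≤-refl))

module Tabulated (size : ℕ → ℚ) where

  input : ℕ → List ℚ
  input n = map size (upTo n)

  input-suc : ∀ n → input (suc n) ≡ input n ∷ʳ size n
  input-suc n = trans (cong (map size) (sym (ListP.upTo-∷ʳ n))) (ListP.map-++ size (upTo n) (n ∷ []))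

  input-valid : (∀ i → ValidSize (size i)) → ∀ n → ValidInput (input n)
  input-valid valid n = AllP.map⁺ (All.tabulate (λ {i} _ → valid i))

  indexed-input : ∀ n → indexed (input n) ≡ map (λ i → i , size i) (upTo n)
  indexed-input n = trans (cong (λ m → zip (upTo m) (input n)) (trans (ListP.length-map size (upTo n)) (ListP.length-upTo n)))
                          (zip-map-self size (upTo n))

  ∑-filter-indexed : ∀ {P : Pred ℕ ℓ} (P? : Decidable P) n →
    sumℚ (map proj₂ (filter (P? ∘ proj₁) (indexed (input n)))) ≡ ∑ size (filter P? (upTo n))
  ∑-filter-indexed P? n = begin
    sumℚ (map proj₂ (filter (P? ∘ proj₁) (indexed (input n))))
      ≡⟨ cong (λ xs → sumℚ (map proj₂ (filter (P? ∘ proj₁) xs))) (indexed-input n) ⟩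
    sumℚ (map proj₂ (filter (P? ∘ proj₁) (map (λ i → i , size i) (upTo n))))
      ≡⟨ cong (sumℚ ∘ map proj₂) (filter-map (P? ∘ proj₁) (λ i → i , size i) (upTo n)) ⟩
    sumℚ (map proj₂ (map (λ i → i , size i) (filter P? (upTo n))))
      ≡⟨ cong sumℚ (ListP.map-∘ (filter P? (upTo n))) ⟨
    ∑ size (filter P? (upTo n))                                                ∎
    where open ≡-Reasoning

  load-input : ∀ n p b → load (input n) p b ≡ binWeight p size (upTo n) b
  load-input n p b = ∑-filter-indexed (λ i → p i ℕ.≟ b) n

  migrated-input : ∀ n p q → migrated (input n) p q ≡ ∑ size (filter (λ i → ¬? (p i ℕ.≟ q i)) (upTo n))
  migrated-input n p q = ∑-filter-indexed (λ i → ¬? (p i ℕ.≟ q i)) n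

  binsUsed-input : ∀ n p → binsUsed (input n) p ≡ length (deduplicate ℕ._≟_ (map p (upTo n)))
  binsUsed-input n p = cong (λ m → length (deduplicate ℕ._≟_ (map p (upTo m))))
                             (trans (ListP.length-map size (upTo n)) (ListP.length-upTo n))

  ∑-≤-binsUsed : ∀ n p (w : ℕ → ℚ) → (∀ b → binWeight p w (upTo n) b ≤ 1ℚ) → ∑ w (upTo n) ≤ ℕtoℚ (binsUsed (input n) p)
  ∑-≤-binsUsed n p w ≤1 = subst (∑ w (upTo n) ≤_) (cong ℕtoℚ (sym (binsUsed-input n p))) (∑-≤-numberOfBins p w (upTo n) ≤1)

  binsUsed-≤ : ∀ n p c → (∀ {i} → i ℕ.< n → p i ℕ.< c) → binsUsed (input n) p ℕ.≤ c
  binsUsed-≤ n p c p<c = subst (ℕ._≤ c) (sym (binsUsed-input n p))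
    (Unique∧interval⇒length≤ c 0 _ (deduplicate-! (map p (upTo n))) (All.tabulate in-range))
    where
    in-range : ∀ {b} → b ∈ deduplicate ℕ._≟_ (map p (upTo n)) → 0 ℕ.≤ b × b ℕ.< c
    in-range b∈ with ∈-map⁻ p (∈-deduplicate⁻ ℕ._≟_ (map p (upTo n)) b∈)
    ... | i , i∈ , refl = z≤n , p<c (∈-upTo⁻ i∈)

-- The arithmetic of the lower bound

-- Adding 2η times the first inequality to the second eliminates c.
two-phase-inequality : ∀ {m c η ρ} → 0ℚ < m → 0ℚ ≤ η →
  ℕtoℚ 2 * m + (- ½) * c ≤ ρ * m → ℕtoℚ 2 * m + η * c ≤ ρ * (ℕtoℚ 2 * m) →
  η ≤ (ρ - 1ℚ) * (1ℚ + η)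
two-phase-inequality {m} {c} {η} {ρ} m>0 η≥0 first second =
  0≤q-p⇒p≤q (subst (0ℚ ≤_) halve (*-nonNeg {½} (*≤* (ℤ.+≤+ z≤n)) (p≤q⇒0≤q-p cancelled)))
  where
  open ℚ-Solver
  combined : m * (ℕtoℚ 4 * η + ℕtoℚ 2) ≤ m * (ρ * (ℕtoℚ 2 * η + ℕtoℚ 2))
  combined = subst₂ _≤_
    (solve 4 (λ m c h r → con (ℕtoℚ 2) :* h :* (con (ℕtoℚ 2) :* m :+ con (- ½) :* c) :+ (con (ℕtoℚ 2) :* m :+ h :* c)
                          := m :* (con (ℕtoℚ 4) :* h :+ con (ℕtoℚ 2))) refl m c η ρ)
    (solve 3 (λ m h r → con (ℕtoℚ 2) :* h :* (r :* m) :+ r :* (con (ℕtoℚ 2) :* m)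
                        := m :* (r :* (con (ℕtoℚ 2) :* h :+ con (ℕtoℚ 2)))) refl m η ρ)
    (+-mono-≤ (*-monoˡ-≤-nonNeg (ℕtoℚ 2 * η) {{nonNegative (*-nonNeg (ℕtoℚ-nonNeg 2) η≥0)}} first) second)
  cancelled : ℕtoℚ 4 * η + ℕtoℚ 2 ≤ ρ * (ℕtoℚ 2 * η + ℕtoℚ 2)
  cancelled = *-cancelˡ-≤-pos m {{positive m>0}} combined
  halve : ½ * (ρ * (ℕtoℚ 2 * η + ℕtoℚ 2) - (ℕtoℚ 4 * η + ℕtoℚ 2)) ≡ (ρ - 1ℚ) * (1ℚ + η) - η
  halve = solve 2 (λ h r → con ½ :* (r :* (con (ℕtoℚ 2) :* h :+ con (ℕtoℚ 2)) :- (con (ℕtoℚ 4) :* h :+ con (ℕtoℚ 2)))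
                           := (r :- con 1ℚ) :* (con 1ℚ :+ h) :- h) refl η ρ

least-step-above : ∀ q → ∃ λ t → q < ℕtoℚ (6 ℕ.+ 5 ℕ.* t) × (t ≡ 0 ⊎ ℕtoℚ (1 ℕ.+ 5 ℕ.* t) ≤ q)
least-step-above q with ℕtoℚ-unbounded q
... | n , q<n = descend n (<-≤-trans q<n (ℕtoℚ-mono-≤ (ℕP.≤-trans (ℕP.m≤n*m n 5) (ℕP.m≤n+m (5 ℕ.* n) 6))))
  where
  descend : ∀ n → q < ℕtoℚ (6 ℕ.+ 5 ℕ.* n) → ∃ λ t → q < ℕtoℚ (6 ℕ.+ 5 ℕ.* t) × (t ≡ 0 ⊎ ℕtoℚ (1 ℕ.+ 5 ℕ.* t) ≤ q)
  descend zero    q<6 = 0 , q<6 , inj₁ refl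
  descend (suc n) q<  with q <? ℕtoℚ (6 ℕ.+ 5 ℕ.* n)
  ... | yes q<′ = descend n q<′
  ... | no  q≮  = suc n , q< , inj₂ (subst (λ k → ℕtoℚ (1 ℕ.+ k) ≤ q) (sym (ℕP.*-suc 5 n)) (≮⇒≥ q≮))

-- For the least t with 5γ < 6+5t, 1 − ε(9+5t) is a positive combination of ε, the slack
-- 1 − (6εγ + 11ε) and 5γ − (1+5t).
choose-t : ∀ {ε γ} → 0ℚ < ε → 0ℚ ≤ γ → ℕtoℚ 6 * ε * γ + ℕtoℚ 11 * ε ≤ 1ℚ →
           ∃ λ t → ℕtoℚ 5 * γ < ℕtoℚ (6 ℕ.+ 5 ℕ.* t) × ε * ℕtoℚ (9 ℕ.+ 5 ℕ.* t) < 1ℚ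
choose-t {ε} {γ} ε>0 γ≥0 6εγ+11ε≤1 = from-step (least-step-above (ℕtoℚ 5 * γ))
  where
  open ℚ-Solver
  slack : ℚ
  slack = 1ℚ - (ℕtoℚ 6 * ε * γ + ℕtoℚ 11 * ε)
  slack≥0 : 0ℚ ≤ slack
  slack≥0 = p≤q⇒0≤q-p 6εγ+11ε≤1
  ε≥0 : 0ℚ ≤ ε
  ε≥0 = <⇒≤ ε>0
  ℕtoℚ-c+5t : ∀ c t → ℕtoℚ (c ℕ.+ 5 ℕ.* t) ≡ ℕtoℚ c + ℕtoℚ 5 * ℕtoℚ t
  ℕtoℚ-c+5t c t = trans (ℕtoℚ-+ c (5 ℕ.* t)) (cong (_+_ (ℕtoℚ c)) (ℕtoℚ-* 5 t))

  from-step : (∃ λ t → ℕtoℚ 5 * γ < ℕtoℚ (6 ℕ.+ 5 ℕ.* t) × (t ≡ 0 ⊎ ℕtoℚ (1 ℕ.+ 5 ℕ.* t) ≤ ℕtoℚ 5 * γ)) →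
              ∃ λ t → ℕtoℚ 5 * γ < ℕtoℚ (6 ℕ.+ 5 ℕ.* t) × ε * ℕtoℚ (9 ℕ.+ 5 ℕ.* t) < 1ℚ
  from-step (t , 5γ<6+5t , inj₁ refl) = 0 , 5γ<6+5t , 0<q-p⇒p<q (subst (0ℚ <_) identity
    (+-mono-<-≤ (*-pos {ℕtoℚ 2} (ℕtoℚ-mono-< {0} {2} (s≤s z≤n)) ε>0)
                (+-mono-≤ slack≥0 (*-nonNeg (ℕtoℚ-nonNeg 6) (*-nonNeg ε≥0 γ≥0)))))
    where
    identity : ℕtoℚ 2 * ε + (slack + ℕtoℚ 6 * (ε * γ)) ≡ 1ℚ - ε * ℕtoℚ 9
    identity = solve 2 (λ e g → con (ℕtoℚ 2) :* e
                                  :+ ((con 1ℚ :- (con (ℕtoℚ 6) :* e :* g :+ con (ℕtoℚ 11) :* e)) :+ con (ℕtoℚ 6) :* (e :* g))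
                                := con 1ℚ :- e :* con (ℕtoℚ 9)) refl ε γ
  from-step (t , 5γ<6+5t , inj₂ 1+5t≤5γ) = t , 5γ<6+5t ,
    0<q-p⇒p<q (*-cancelˡ-<-nonNeg (ℕtoℚ 6) {{nonNegative (ℕtoℚ-nonNeg 6)}} (subst₂ _<_ (sym (*-zeroʳ (ℕtoℚ 6))) identity
      (+-mono-<-≤ (+-mono-<-≤ (ℕtoℚ-mono-< {0} {1} (s≤s z≤n)) (*-nonNeg (ℕtoℚ-nonNeg 7) ε≥0))
                  (+-mono-≤ (*-nonNeg (ℕtoℚ-nonNeg 5) slack≥0) (*-nonNeg (*-nonNeg (ℕtoℚ-nonNeg 6) ε≥0) (p≤q⇒0≤q-p 1+5t≤5γ))))))
    where
    T = ℕtoℚ t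
    identity′ : (1ℚ + ℕtoℚ 7 * ε) + (ℕtoℚ 5 * slack + ℕtoℚ 6 * ε * (ℕtoℚ 5 * γ - (ℕtoℚ 1 + ℕtoℚ 5 * T)))
                ≡ ℕtoℚ 6 * (1ℚ - ε * (ℕtoℚ 9 + ℕtoℚ 5 * T))
    identity′ = solve 3 (λ e g x → (con 1ℚ :+ con (ℕtoℚ 7) :* e)
                                     :+ (con (ℕtoℚ 5) :* (con 1ℚ :- (con (ℕtoℚ 6) :* e :* g :+ con (ℕtoℚ 11) :* e))
                                         :+ con (ℕtoℚ 6) :* e :* (con (ℕtoℚ 5) :* g :- (con (ℕtoℚ 1) :+ con (ℕtoℚ 5) :* x)))
                                   := con (ℕtoℚ 6) :* (con 1ℚ :- e :* (con (ℕtoℚ 9) :+ con (ℕtoℚ 5) :* x))) refl ε γ T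
    identity : (1ℚ + ℕtoℚ 7 * ε) + (ℕtoℚ 5 * slack + ℕtoℚ 6 * ε * (ℕtoℚ 5 * γ - ℕtoℚ (1 ℕ.+ 5 ℕ.* t)))
               ≡ ℕtoℚ 6 * (1ℚ - ε * ℕtoℚ (9 ℕ.+ 5 ℕ.* t))
    identity = subst₂ (λ a b → (1ℚ + ℕtoℚ 7 * ε) + (ℕtoℚ 5 * slack + ℕtoℚ 6 * ε * (ℕtoℚ 5 * γ - a)) ≡ ℕtoℚ 6 * (1ℚ - ε * b))
                      (sym (ℕtoℚ-c+5t 1 t)) (sym (ℕtoℚ-c+5t 9 t)) identity′

migrationBound⇒6εγ+11ε≤1 : ∀ ε (ε>0 : 0ℚ < ε) γ → γ ≤ migrationBound ε ε>0 → ℕtoℚ 6 * ε * γ + ℕtoℚ 11 * ε ≤ 1ℚ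
migrationBound⇒6εγ+11ε≤1 ε ε>0 γ γ≤bound = begin
  ℕtoℚ 6 * ε * γ + ℕtoℚ 11 * ε                          ≤⟨ +-monoˡ-≤ (ℕtoℚ 11 * ε) (*-monoˡ-≤-nonNeg (ℕtoℚ 6 * ε) {{6ε≥0}} γ≤bound) ⟩
  ℕtoℚ 6 * ε * migrationBound ε ε>0 + ℕtoℚ 11 * ε
    ≡⟨ solve 2 (λ e i → con (ℕtoℚ 6) :* e :* (con (+ 1 / 6) :* (i :- con (ℕtoℚ 11))) :+ con (ℕtoℚ 11) :* e := e :* i) refl ε ε⁻¹ ⟩
  ε * ε⁻¹                                               ≡⟨ *-inverseʳ ε {{>-nonZero ε>0}} ⟩
  1ℚ                                                    ∎
  where
  open ≤-Reasoning
  open ℚ-Solver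
  ε⁻¹ : ℚ
  ε⁻¹ = (1/ ε) {{>-nonZero ε>0}}
  6ε≥0 : NonNegative (ℕtoℚ 6 * ε)
  6ε≥0 = nonNegative (*-nonNeg (ℕtoℚ-nonNeg 6) (<⇒≤ ε>0))

-- The adversarial instance

module Units (D : ℕ) .{{_ : ℕ.NonZero D}} where

  D>0 : 0ℚ < ℕtoℚ D
  D>0 = ℕtoℚ-mono-< {0} {D} (ℕ.>-nonZero⁻¹ D)

  u : ℚ
  u = (1/ ℕtoℚ D) {{>-nonZero D>0}}

  u>0 : 0ℚ < u
  u>0 = positive⁻¹ u {{1/pos⇒pos (ℕtoℚ D) {{positive D>0}}}}

  units : ℕ → ℚ
  units n = ℕtoℚ n * u

  units-D : units D ≡ 1ℚ
  units-D = *-inverseʳ (ℕtoℚ D) {{>-nonZero D>0}}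

  units-+ : ∀ m n → units (m ℕ.+ n) ≡ units m + units n
  units-+ m n = trans (cong (_* u) (ℕtoℚ-+ m n)) (*-distribʳ-+ u (ℕtoℚ m) (ℕtoℚ n))

  units-* : ∀ m c → units m * ℕtoℚ c ≡ units (m ℕ.* c)
  units-* m c = trans (solve 3 (λ x y z → x :* z :* y := x :* y :* z) refl (ℕtoℚ m) (ℕtoℚ c) u)
                      (cong (_* u) (sym (ℕtoℚ-* m c)))
    where open ℚ-Solver

  units-mono-< : ∀ {m n} → m ℕ.< n → units m < units n
  units-mono-< m<n = *-monoˡ-<-pos u {{positive u>0}} (ℕtoℚ-mono-< m<n)

  units-mono-≤ : ∀ {m n} → m ℕ.≤ n → units m ≤ units n
  units-mono-≤ m≤n = *-monoʳ-≤-nonNeg u {{nonNegative (<⇒≤ u>0)}} (ℕtoℚ-mono-≤ m≤n)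

  units-pos : ∀ {n} → 0 ℕ.< n → 0ℚ < units n
  units-pos {n} 0<n = subst (_< units n) (*-zeroˡ u) (units-mono-< 0<n)

-- All sizes are integer multiples of u = 1/D, so that comparisons between them reduce to ℕ.
module Sizes (t : ℕ) where

  D : ℕ
  D = 16 ℕ.+ 10 ℕ.* t

  open Units D public

  large small η : ℚ
  large = units (6 ℕ.+ 5 ℕ.* t)
  small = units 5
  η     = units 2

  k : ℕ
  k = 2 ℕ.+ t

  private
    module NS = +-*-Solver

  large>0 : 0ℚ < large
  large>0 = units-pos {6 ℕ.+ 5 ℕ.* t} (s≤s z≤n)

  small>0 : 0ℚ < small
  small>0 = units-pos {5} (s≤s z≤n)

  η>0 : 0ℚ < η
  η>0 = units-pos {2} (s≤s z≤n)

  large≤1 : large ≤ 1ℚ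
  large≤1 = subst (large ≤_) units-D (units-mono-≤ (m+d≡n⇒m≤n (6 ℕ.+ 5 ℕ.* t) (10 ℕ.+ 5 ℕ.* t)
              (NS.solve 1 (λ t → (con 6 :+ con 5 :* t) :+ (con 10 :+ con 5 :* t) := con 16 :+ con 10 :* t) refl t)))
    where open NS

  small≤large : small ≤ large
  small≤large = units-mono-≤ (m+d≡n⇒m≤n 5 (1 ℕ.+ 5 ℕ.* t) refl)

  three-large>1 : 1ℚ < large * ℕtoℚ 3
  three-large>1 = subst₂ _<_ units-D (sym (units-* (6 ℕ.+ 5 ℕ.* t) 3)) (units-mono-< (m+d≡n⇒m≤n (suc D) (1 ℕ.+ 5 ℕ.* t)
                    (NS.solve 1 (λ t → con 1 :+ (con 16 :+ con 10 :* t) :+ (con 1 :+ con 5 :* t) := (con 6 :+ con 5 :* t) :* con 3) refl t)))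
    where open NS

  two-large≤1 : large * ℕtoℚ 2 ≤ 1ℚ
  two-large≤1 = subst₂ _≤_ (sym (units-* (6 ℕ.+ 5 ℕ.* t) 2)) units-D (units-mono-≤ (m+d≡n⇒m≤n ((6 ℕ.+ 5 ℕ.* t) ℕ.* 2) 4
                  (NS.solve 1 (λ t → (con 6 :+ con 5 :* t) :* con 2 :+ con 4 := con 16 :+ con 10 :* t) refl t)))
    where open NS

  two-large+small>1 : 1ℚ < large * ℕtoℚ 2 + small
  two-large+small>1 = subst₂ _<_ units-D
                        (trans (units-+ ((6 ℕ.+ 5 ℕ.* t) ℕ.* 2) 5) (cong (_+ small) (sym (units-* (6 ℕ.+ 5 ℕ.* t) 2))))
                        (units-mono-< (m+d≡n⇒m≤n (suc D) 0
                          (NS.solve 1 (λ t → con 1 :+ (con 16 :+ con 10 :* t) :+ con 0 := (con 6 :+ con 5 :* t) :* con 2 :+ con 5) refl t)))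
    where open NS

  two-large+two-η≡1 : large * ℕtoℚ 2 + η * ℕtoℚ 2 ≡ 1ℚ
  two-large+two-η≡1 = begin
    large * ℕtoℚ 2 + η * ℕtoℚ 2                  ≡⟨ cong₂ _+_ (units-* (6 ℕ.+ 5 ℕ.* t) 2) (units-* 2 2) ⟩
    units ((6 ℕ.+ 5 ℕ.* t) ℕ.* 2) + units 4      ≡⟨ units-+ ((6 ℕ.+ 5 ℕ.* t) ℕ.* 2) 4 ⟨
    units ((6 ℕ.+ 5 ℕ.* t) ℕ.* 2 ℕ.+ 4)          ≡⟨ cong units (NS.solve 1 (λ t → (con 6 :+ con 5 :* t) :* con 2 :+ con 4 := con 16 :+ con 10 :* t) refl t) ⟩
    units D                                      ≡⟨ units-D ⟩
    1ℚ                                           ∎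
    where
    open ≡-Reasoning
    open NS

  large+k-small≡1 : large + small * ℕtoℚ k ≡ 1ℚ
  large+k-small≡1 = begin
    large + small * ℕtoℚ k                       ≡⟨ cong (_+_ large) (units-* 5 k) ⟩
    large + units (5 ℕ.* k)                      ≡⟨ units-+ (6 ℕ.+ 5 ℕ.* t) (5 ℕ.* k) ⟨
    units (6 ℕ.+ 5 ℕ.* t ℕ.+ 5 ℕ.* k)            ≡⟨ cong units (NS.solve 1 (λ t → con 6 :+ con 5 :* t :+ con 5 :* (con 2 :+ t) := con 16 :+ con 10 :* t) refl t) ⟩
    units D                                      ≡⟨ units-D ⟩
    1ℚ                                           ∎
    where
    open ≡-Reasoning
    open NS

  X : ℕ
  X = 9 ℕ.+ 5 ℕ.* t

  1+η≡X*η : 1ℚ + η ≡ ℕtoℚ X * η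
  1+η≡X*η = begin
    1ℚ + η                 ≡⟨ cong (_+ η) units-D ⟨
    units D + units 2      ≡⟨ units-+ D 2 ⟨
    units (D ℕ.+ 2)        ≡⟨ cong units (NS.solve 1 (λ t → con 16 :+ con 10 :* t :+ con 2 := con 2 :* (con 9 :+ con 5 :* t)) refl t) ⟩
    units (2 ℕ.* X)        ≡⟨ units-* 2 X ⟨
    η * ℕtoℚ X             ≡⟨ *-comm η (ℕtoℚ X) ⟩
    ℕtoℚ X * η             ∎
    where
    open ≡-Reasoning
    open NS

  units-X<1 : units X < 1ℚ
  units-X<1 = subst (units X <_) units-D (units-mono-< (m+d≡n⇒m≤n (suc X) (6 ℕ.+ 5 ℕ.* t)
                (NS.solve 1 (λ t → con 1 :+ (con 9 :+ con 5 :* t) :+ (con 6 :+ con 5 :* t) := con 16 :+ con 10 :* t) refl t)))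
    where open NS

  5γ<6+5t⇒γ*small<large : ∀ {γ} → ℕtoℚ 5 * γ < ℕtoℚ (6 ℕ.+ 5 ℕ.* t) → γ * small < large
  5γ<6+5t⇒γ*small<large {γ} 5γ<6+5t = subst (_< large) (solve 3 (λ f g x → f :* g :* x := g :* (f :* x)) refl (ℕtoℚ 5) γ u)
                                (*-monoˡ-<-pos u {{positive u>0}} 5γ<6+5t)
    where open ℚ-Solver

  -- δ is chosen so that (ε + δ)·X < 1 still holds, because u·X < 1.
  δ : ℚ → ℚ
  δ ε = (1ℚ - ε * ℕtoℚ X) * u

  δ>0 : ∀ {ε} → ε * ℕtoℚ X < 1ℚ → 0ℚ < δ ε
  δ>0 εX<1 = *-pos (p<q⇒0<q-p εX<1) u>0

  no-room : ∀ {ε} → ε * ℕtoℚ X < 1ℚ → ¬ η ≤ (1ℚ + ε + δ ε - 1ℚ) * (1ℚ + η)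
  no-room {ε} εX<1 η≤ = <-irrefl refl (begin-strict
    1ℚ                                              ≤⟨ *-cancelʳ-≤-pos η {{positive η>0}} (begin
      1ℚ * η                                          ≡⟨ *-identityˡ η ⟩
      η                                               ≤⟨ η≤ ⟩
      (1ℚ + ε + δ ε - 1ℚ) * (1ℚ + η)                  ≡⟨ cong (_*_ (1ℚ + ε + δ ε - 1ℚ)) 1+η≡X*η ⟩
      (1ℚ + ε + δ ε - 1ℚ) * (ℕtoℚ X * η)              ≡⟨ solve 4 (λ e s x h → (con 1ℚ :+ e :+ s :- con 1ℚ) :* (x :* h) := ((e :+ s) :* x) :* h) refl ε (δ ε) (ℕtoℚ X) η ⟩
      ((ε + δ ε) * ℕtoℚ X) * η                        ∎) ⟩
    (ε + δ ε) * ℕtoℚ X                              ≡⟨ solve 4 (λ e x v c → (e :+ c :* v) :* x := e :* x :+ c :* (x :* v)) refl ε (ℕtoℚ X) u (1ℚ - ε * ℕtoℚ X) ⟩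
    ε * ℕtoℚ X + (1ℚ - ε * ℕtoℚ X) * units X
      <⟨ +-monoʳ-< (ε * ℕtoℚ X) (*-monoʳ-<-pos (1ℚ - ε * ℕtoℚ X) {{positive (p<q⇒0<q-p εX<1)}} units-X<1) ⟩
    ε * ℕtoℚ X + (1ℚ - ε * ℕtoℚ X) * 1ℚ             ≡⟨ solve 1 (λ y → y :+ (con 1ℚ :- y) :* con 1ℚ := con 1ℚ) refl (ε * ℕtoℚ X) ⟩
    1ℚ                                              ∎)
    where
    open ≤-Reasoning
    open ℚ-Solver

module Instance (t M : ℕ) where

  open Sizes t public

  L : ℕ
  L = 2 ℕ.* M

  size : ℕ → ℚ
  size i = if does (i ℕ.<? L) then large else small

  size-large : ∀ {i} → i ℕ.< L → size i ≡ large
  size-large {i} i<L = cong (if_then large else small) (dec-true (i ℕ.<? L) i<L)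

  size-small : ∀ {i} → ¬ i ℕ.< L → size i ≡ small
  size-small {i} i≮L = cong (if_then large else small) (dec-false (i ℕ.<? L) i≮L)

  size-elim : ∀ (P : ℚ → Set) → P large → P small → ∀ i → P (size i)
  size-elim P P-large P-small i = by-cases (does (i ℕ.<? L))
    where
    by-cases : ∀ b → P (if b then large else small)
    by-cases true  = P-large
    by-cases false = P-small

  small≤size : ∀ i → small ≤ size i
  small≤size = size-elim (small ≤_) small≤large ≤-refl

  small-valid : ValidSize small
  small-valid = small>0 , ≤-trans small≤large large≤1

  size-valid : ∀ i → ValidSize (size i)
  size-valid = size-elim ValidSize (large>0 , large≤1) small-valid

  size-nonNeg : ∀ i → 0ℚ ≤ size i
  size-nonNeg i = <⇒≤ (proj₁ (size-valid i))

  open Tabulated size public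

  phase : ℕ → List ℚ
  phase r = input (L ℕ.+ r)

  ∑-size-large : ∀ xs → All (ℕ._< L) xs → ∑ size xs ≡ large * ℕtoℚ (length xs)
  ∑-size-large xs all<L = ∑-const (All.map size-large all<L)

  at-most-two-large : ∀ xs → All (ℕ._< L) xs → ∑ size xs ≤ 1ℚ → length xs ℕ.≤ 2
  at-most-two-large xs all<L ≤1 = ℕP.≮⇒≥ λ 2<length → <-irrefl refl (begin-strict
    1ℚ                           <⟨ three-large>1 ⟩
    large * ℕtoℚ 3               ≤⟨ *-monoˡ-≤-nonNeg large {{nonNegative (<⇒≤ large>0)}} (ℕtoℚ-mono-≤ 2<length) ⟩
    large * ℕtoℚ (length xs)     ≡⟨ ∑-size-large xs all<L ⟨
    ∑ size xs                    ≤⟨ ≤1 ⟩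
    1ℚ                           ∎)
    where open ≤-Reasoning

  L+0≡L : L ℕ.+ 0 ≡ L
  L+0≡L = ℕP.+-identityʳ L

  phase0-bin-large : ∀ (p : ℕ → ℕ) b → All (ℕ._< L) (filter (λ i → p i ℕ.≟ b) (upTo (L ℕ.+ 0)))
  phase0-bin-large p b = subst (λ n → All (ℕ._< n) (filter (λ i → p i ℕ.≟ b) (upTo (L ℕ.+ 0)))) L+0≡L
                               (All<-filter-upTo (λ i → p i ℕ.≟ b) (L ℕ.+ 0))

  phase0-lower : ∀ p → Feasible (phase 0) p → M ℕ.≤ binsUsed (phase 0) p
  phase0-lower p feasible = ℕtoℚ-cancel-≤ (begin
    ℕtoℚ M                               ≡⟨ total ⟨
    ∑ (λ _ → ½) (upTo (L ℕ.+ 0))         ≤⟨ ∑-≤-binsUsed (L ℕ.+ 0) p (λ _ → ½) half-per-item ⟩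
    ℕtoℚ (binsUsed (phase 0) p)          ∎)
    where
    open ≤-Reasoning
    half-per-item : ∀ b → binWeight p (λ _ → ½) (upTo (L ℕ.+ 0)) b ≤ 1ℚ
    half-per-item b = begin
      ∑ (λ _ → ½) bin                    ≡⟨ ∑-const {xs = bin} (All.tabulate (λ _ → refl)) ⟩
      ½ * ℕtoℚ (length bin)              ≤⟨ *-monoˡ-≤-nonNeg ½ (ℕtoℚ-mono-≤ (at-most-two-large bin (phase0-bin-large p b)
                                              (subst (_≤ 1ℚ) (load-input (L ℕ.+ 0) p b) (feasible b)))) ⟩
      ½ * ℕtoℚ 2                         ≡⟨⟩
      1ℚ                                 ∎
      where bin = filter (λ i → p i ℕ.≟ b) (upTo (L ℕ.+ 0))
    total : ∑ (λ _ → ½) (upTo (L ℕ.+ 0)) ≡ ℕtoℚ M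
    total = begin-equality
      ∑ (λ _ → ½) (upTo (L ℕ.+ 0))       ≡⟨ ∑-const {xs = upTo (L ℕ.+ 0)} (All.tabulate (λ _ → refl)) ⟩
      ½ * ℕtoℚ (length (upTo (L ℕ.+ 0))) ≡⟨ cong (λ n → ½ * ℕtoℚ n) (trans (ListP.length-upTo (L ℕ.+ 0)) L+0≡L) ⟩
      ½ * ℕtoℚ (2 ℕ.* M)                 ≡⟨ cong (_*_ ½) (ℕtoℚ-* 2 M) ⟩
      ½ * (ℕtoℚ 2 * ℕtoℚ M)              ≡⟨ solve 1 (λ m → con ½ :* (con (ℕtoℚ 2) :* m) := m) refl (ℕtoℚ M) ⟩
      ℕtoℚ M                             ∎
      where open ℚ-Solver

  pairUp : ℕ → ℕ
  pairUp i = i ℕ./ 2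

  pairUp-feasible : Feasible (phase 0) pairUp
  pairUp-feasible b = begin
    load (phase 0) pairUp b           ≡⟨ load-input (L ℕ.+ 0) pairUp b ⟩
    ∑ size bin                        ≡⟨ ∑-size-large bin (phase0-bin-large pairUp b) ⟩
    large * ℕtoℚ (length bin)         ≤⟨ *-monoˡ-≤-nonNeg large {{nonNegative (<⇒≤ large>0)}} (ℕtoℚ-mono-≤ two-per-bin) ⟩
    large * ℕtoℚ 2                    ≤⟨ two-large≤1 ⟩
    1ℚ                                ∎
    where
    open ≤-Reasoning
    bin = filter (λ i → pairUp i ℕ.≟ b) (upTo (L ℕ.+ 0))
    in-pair : ∀ {i} → i ∈ bin → b ℕ.* 2 ℕ.≤ i × i ℕ.< b ℕ.* 2 ℕ.+ 2
    in-pair {i} i∈ with ∈-filter⁻ (λ i → pairUp i ℕ.≟ b) {xs = upTo (L ℕ.+ 0)} i∈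
    ... | _ , refl = div-interval i 2
    two-per-bin : length bin ℕ.≤ 2
    two-per-bin = Unique∧interval⇒length≤ 2 (b ℕ.* 2) bin (Unique-filter-upTo _ (L ℕ.+ 0)) (All.tabulate in-pair)

  pairUp-binsUsed : binsUsed (phase 0) pairUp ℕ.≤ M
  pairUp-binsUsed = binsUsed-≤ (L ℕ.+ 0) pairUp M (λ {i} i<L+0 → m<n*o⇒m/o<n (subst (i ℕ.<_) L+0≡M*2 i<L+0))
    where
    L+0≡M*2 : L ℕ.+ 0 ≡ M ℕ.* 2
    L+0≡M*2 = trans L+0≡L (ℕP.*-comm 2 M)

  phase0-OPT : IsOPT (phase 0) M
  phase0-OPT = isOPT (phase 0) M pairUp pairUp-feasible pairUp-binsUsed phase0-lower

  R : ℕ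
  R = L ℕ.* k

  ∑-size-phase : ∀ r → ∑ size (upTo (L ℕ.+ r)) ≡ large * ℕtoℚ L + small * ℕtoℚ r
  ∑-size-phase zero = begin
    ∑ size (upTo (L ℕ.+ 0))                    ≡⟨ ∑-size-large _ (subst (λ n → All (ℕ._< n) (upTo (L ℕ.+ 0))) L+0≡L (All.tabulate ∈-upTo⁻)) ⟩
    large * ℕtoℚ (length (upTo (L ℕ.+ 0)))     ≡⟨ cong (λ n → large * ℕtoℚ n) (trans (ListP.length-upTo (L ℕ.+ 0)) L+0≡L) ⟩
    large * ℕtoℚ L                             ≡⟨ +-identityʳ _ ⟨
    large * ℕtoℚ L + 0ℚ                        ≡⟨ cong (_+_ (large * ℕtoℚ L)) (*-zeroʳ small) ⟨
    large * ℕtoℚ L + small * 0ℚ                ∎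
    where open ≡-Reasoning
  ∑-size-phase (suc r) = begin
    ∑ size (upTo (L ℕ.+ suc r))                ≡⟨ cong (∑ size ∘ upTo) (ℕP.+-suc L r) ⟩
    ∑ size (upTo (suc (L ℕ.+ r)))              ≡⟨ ∑-upTo-suc size (L ℕ.+ r) ⟩
    ∑ size (upTo (L ℕ.+ r)) + size (L ℕ.+ r)   ≡⟨ cong₂ _+_ (∑-size-phase r) (size-small (ℕP.≤⇒≯ (ℕP.m≤m+n L r))) ⟩
    large * ℕtoℚ L + small * ℕtoℚ r + small    ≡⟨ solve 4 (λ a l s r → a :* l :+ s :* r :+ s := a :* l :+ s :* (con 1ℚ :+ r)) refl large (ℕtoℚ L) small (ℕtoℚ r) ⟩
    large * ℕtoℚ L + small * (1ℚ + ℕtoℚ r)     ≡⟨ cong (λ x → large * ℕtoℚ L + small * x) (ℕtoℚ-suc r) ⟨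
    large * ℕtoℚ L + small * ℕtoℚ (suc r)      ∎
    where
    open ≡-Reasoning
    open ℚ-Solver

  ∑-size-phaseR : ∑ size (upTo (L ℕ.+ R)) ≡ ℕtoℚ L
  ∑-size-phaseR = begin
    ∑ size (upTo (L ℕ.+ R))                    ≡⟨ ∑-size-phase R ⟩
    large * ℕtoℚ L + small * ℕtoℚ (L ℕ.* k)    ≡⟨ cong (λ x → large * ℕtoℚ L + small * x) (ℕtoℚ-* L k) ⟩
    large * ℕtoℚ L + small * (ℕtoℚ L * ℕtoℚ k) ≡⟨ solve 4 (λ a s l k → a :* l :+ s :* (l :* k) := l :* (a :+ s :* k)) refl large small (ℕtoℚ L) (ℕtoℚ k) ⟩
    ℕtoℚ L * (large + small * ℕtoℚ k)          ≡⟨ cong (_*_ (ℕtoℚ L)) large+k-small≡1 ⟩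
    ℕtoℚ L * 1ℚ                                ≡⟨ *-identityʳ (ℕtoℚ L) ⟩
    ℕtoℚ L                                     ∎
    where
    open ≡-Reasoning
    open ℚ-Solver

  phaseR-lower : ∀ p → Feasible (phase R) p → L ℕ.≤ binsUsed (phase R) p
  phaseR-lower p feasible = ℕtoℚ-cancel-≤ (subst (_≤ ℕtoℚ (binsUsed (phase R) p)) ∑-size-phaseR
    (∑-≤-binsUsed (L ℕ.+ R) p size (λ b → subst (_≤ 1ℚ) (load-input (L ℕ.+ R) p b) (feasible b))))

  fill : ℕ → ℕ
  fill i = if does (i ℕ.<? L) then i else (i ℕ.∸ L) ℕ./ k

  fill-large : ∀ {i} → i ℕ.< L → fill i ≡ i
  fill-large {i} i<L = cong (if_then i else (i ℕ.∸ L) ℕ./ k) (dec-true (i ℕ.<? L) i<L)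

  fill-small : ∀ {i} → ¬ i ℕ.< L → fill i ≡ (i ℕ.∸ L) ℕ./ k
  fill-small {i} i≮L = cong (if_then i else (i ℕ.∸ L) ℕ./ k) (dec-false (i ℕ.<? L) i≮L)

  fill-small-block : ∀ {i} → ¬ i ℕ.< L → L ℕ.+ fill i ℕ.* k ℕ.≤ i × i ℕ.< L ℕ.+ fill i ℕ.* k ℕ.+ k
  fill-small-block {i} i≮L =
    subst (λ c → L ℕ.+ c ℕ.* k ℕ.≤ i × i ℕ.< L ℕ.+ c ℕ.* k ℕ.+ k) (sym (fill-small i≮L))
      (subst (L ℕ.+ q ℕ.* k ℕ.≤_) L+[i∸L]≡i (ℕP.+-monoʳ-≤ L (proj₁ (div-interval (i ℕ.∸ L) k))) ,
       subst₂ ℕ._<_ L+[i∸L]≡i (sym (ℕP.+-assoc L (q ℕ.* k) k)) (ℕP.+-monoʳ-< L (proj₂ (div-interval (i ℕ.∸ L) k))))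
    where
    q = (i ℕ.∸ L) ℕ./ k
    L+[i∸L]≡i : L ℕ.+ (i ℕ.∸ L) ≡ i
    L+[i∸L]≡i = ℕP.m+[n∸m]≡n (ℕP.≮⇒≥ i≮L)

  fill-binsUsed : binsUsed (phase R) fill ℕ.≤ L
  fill-binsUsed = binsUsed-≤ (L ℕ.+ R) fill L fill<L
    where
    fill<L : ∀ {i} → i ℕ.< L ℕ.+ R → fill i ℕ.< L
    fill<L {i} i<L+R with i ℕ.<? L
    ... | yes i<L = subst (ℕ._< L) (sym (fill-large i<L)) i<L
    ... | no  i≮L = subst (ℕ._< L) (sym (fill-small i≮L))
      (m<n*o⇒m/o<n (ℕP.+-cancelˡ-< L _ _ (subst (ℕ._< L ℕ.+ R) (sym (ℕP.m+[n∸m]≡n (ℕP.≮⇒≥ i≮L))) i<L+R)))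

  fill-feasible : Feasible (phase R) fill
  fill-feasible b = begin
    load (phase R) fill b                         ≡⟨ load-input (L ℕ.+ R) fill b ⟩
    ∑ size bin                                    ≡⟨ ∑-partition (ℕ._<? L) size bin ⟩
    ∑ size larges + ∑ size smalls                 ≡⟨ cong₂ _+_ (∑-size-large larges (AllP.all-filter (ℕ._<? L) bin))
                                                               (∑-const (All.map size-small (AllP.all-filter (∁? (ℕ._<? L)) bin))) ⟩
    large * ℕtoℚ (length larges) + small * ℕtoℚ (length smalls)
      ≤⟨ +-mono-≤ (*-monoˡ-≤-nonNeg large {{nonNegative (<⇒≤ large>0)}} (ℕtoℚ-mono-≤ one-large))
                  (*-monoˡ-≤-nonNeg small {{nonNegative (<⇒≤ small>0)}} (ℕtoℚ-mono-≤ k-small)) ⟩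
    large * 1ℚ + small * ℕtoℚ k                   ≡⟨ cong (_+ small * ℕtoℚ k) (*-identityʳ large) ⟩
    large + small * ℕtoℚ k                        ≡⟨ large+k-small≡1 ⟩
    1ℚ                                            ∎
    where
    open ≤-Reasoning
    bin    = filter (λ i → fill i ℕ.≟ b) (upTo (L ℕ.+ R))
    larges = filter (ℕ._<? L) bin
    smalls = filter (∁? (ℕ._<? L)) bin
    unique-bin : Unique bin
    unique-bin = Unique-filter-upTo (λ i → fill i ℕ.≟ b) (L ℕ.+ R)
    fill≡b : ∀ {i} → i ∈ bin → fill i ≡ b
    fill≡b i∈ = proj₂ (∈-filter⁻ (λ i → fill i ℕ.≟ b) {xs = upTo (L ℕ.+ R)} i∈)
    large≡b : ∀ {i} → i ∈ larges → i ≡ b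
    large≡b i∈ with ∈-filter⁻ (ℕ._<? L) {xs = bin} i∈
    ... | i∈bin , i<L = trans (sym (fill-large i<L)) (fill≡b i∈bin)
    small-in-block : ∀ {i} → i ∈ smalls → L ℕ.+ b ℕ.* k ℕ.≤ i × i ℕ.< L ℕ.+ b ℕ.* k ℕ.+ k
    small-in-block {i} i∈ with ∈-filter⁻ (∁? (ℕ._<? L)) {xs = bin} i∈
    ... | i∈bin , i≮L = subst (λ c → L ℕ.+ c ℕ.* k ℕ.≤ i × i ℕ.< L ℕ.+ c ℕ.* k ℕ.+ k) (fill≡b i∈bin) (fill-small-block i≮L)
    one-large : length larges ℕ.≤ 1
    one-large = Unique∧All≡⇒length≤1 (UniqueP.filter⁺ (ℕ._<? L) unique-bin) (All.tabulate large≡b)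
    k-small : length smalls ℕ.≤ k
    k-small = Unique∧interval⇒length≤ k (L ℕ.+ b ℕ.* k) smalls (UniqueP.filter⁺ (∁? (ℕ._<? L)) unique-bin) (All.tabulate small-in-block)

  phaseR-OPT : IsOPT (phase R) L
  phaseR-OPT = isOPT (phase R) L fill fill-feasible fill-binsUsed phaseR-lower

-- Running an online algorithm on the instance

module Adversary (t M : ℕ) (A : OnlineAlgorithm) (γ : ℚ)
  (feasible  : ∀ σ → ValidInput σ → Feasible σ (A σ))
  (migration : ∀ σ s → ValidInput σ → ValidSize s → migrated σ (A σ) (A (σ ∷ʳ s)) ≤ γ * s)
  (γ*small<large : γ * Sizes.small t < Sizes.large t)
  where

  open Instance t M

  phase-valid : ∀ r → ValidInput (phase r)
  phase-valid r = input-valid size-valid (L ℕ.+ r)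

  phase-suc : ∀ r → phase (suc r) ≡ phase r ∷ʳ small
  phase-suc r = begin
    input (L ℕ.+ suc r)                 ≡⟨ cong input (ℕP.+-suc L r) ⟩
    input (suc (L ℕ.+ r))               ≡⟨ input-suc (L ℕ.+ r) ⟩
    input (L ℕ.+ r) ∷ʳ size (L ℕ.+ r)   ≡⟨ cong (input (L ℕ.+ r) ∷ʳ_) (size-small (ℕP.≤⇒≯ (ℕP.m≤m+n L r))) ⟩
    input (L ℕ.+ r) ∷ʳ small            ∎
    where open ≡-Reasoning

  p₀ : ℕ → ℕ
  p₀ = A (phase 0)

  -- Moving a large item would cost more migration than a small arrival allows.
  large-fixed : ∀ r {i} → i ℕ.< L → A (phase r) i ≡ p₀ i
  large-fixed zero    i<L = refl
  large-fixed (suc r) {i} i<L = by-cases (A (phase r) i ℕ.≟ A (phase (suc r)) i)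
    where
    open ≤-Reasoning
    changed? = λ j → ¬? (A (phase r) j ℕ.≟ A (phase (suc r)) j)
    by-cases : Dec (A (phase r) i ≡ A (phase (suc r)) i) → A (phase (suc r)) i ≡ p₀ i
    by-cases (yes unmoved) = trans (sym unmoved) (large-fixed r i<L)
    by-cases (no  moved)   = ⊥-elim (<-irrefl refl (begin-strict
      γ * small                                                   <⟨ γ*small<large ⟩
      large                                                       ≡⟨ size-large i<L ⟨
      size i                                                      ≤⟨ ∑-∈ (∈-filter⁺ changed? (∈-upTo⁺ (ℕP.<-≤-trans i<L (ℕP.m≤m+n L r))) moved)
                                                                         (All.tabulate (λ {j} _ → size-nonNeg j)) ⟩
      ∑ size (filter changed? (upTo (L ℕ.+ r)))                   ≡⟨ migrated-input (L ℕ.+ r) (A (phase r)) (A (phase (suc r))) ⟨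
      migrated (phase r) (A (phase r)) (A (phase (suc r)))        ≡⟨ cong (λ σ → migrated (phase r) (A (phase r)) (A σ)) (phase-suc r) ⟩
      migrated (phase r) (A (phase r)) (A (phase r ∷ʳ small))     ≤⟨ migration (phase r) small (phase-valid r) small-valid ⟩
      γ * small                                                   ∎))

  Paired : ℕ → Set
  Paired i = i ℕ.< L × Any (λ j → j ≢ i × p₀ j ≡ p₀ i) (upTo L)

  paired? : Decidable Paired
  paired? i = (i ℕ.<? L) ×-dec any? (λ j → ¬? (j ℕ.≟ i) ×-dec (p₀ j ℕ.≟ p₀ i)) (upTo L)

  paired : ℕ → ℚ
  paired i = indicator (paired? i)

  C : ℚ
  C = ∑ paired (upTo (L ℕ.+ 0))

  sharing⇒Paired : ∀ {i j} → i ℕ.< L → j ℕ.< L → j ≢ i → p₀ j ≡ p₀ i → Paired i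
  sharing⇒Paired i<L j<L j≢i same = i<L , lose (∈-upTo⁺ j<L) (j≢i , same)

  partner : ∀ {i} → Paired i → ∃ λ j → j ≢ i × p₀ j ≡ p₀ i × Paired j
  partner {i} (i<L , sharing) = from-witness (find sharing)
    where
    from-witness : (∃ λ j → j ∈ upTo L × j ≢ i × p₀ j ≡ p₀ i) → ∃ λ j → j ≢ i × p₀ j ≡ p₀ i × Paired j
    from-witness (j , j∈ , j≢i , same) = j , j≢i , same , sharing⇒Paired (∈-upTo⁻ j∈) i<L (j≢i ∘ sym) (sym same)

  weight₀ : ℕ → ℚ
  weight₀ i = 1ℚ + (- ½) * paired i

  weight₀≤1 : ∀ i → weight₀ i ≤ 1ℚ
  weight₀≤1 i = by-cases (paired? i)
    where
    by-cases : (d : Dec (Paired i)) → 1ℚ + (- ½) * indicator d ≤ 1ℚ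
    by-cases (yes _) = from-yes (1ℚ + (- ½) * 1ℚ ≤? 1ℚ)
    by-cases (no  _) = from-yes (1ℚ + (- ½) * 0ℚ ≤? 1ℚ)

  weight₀-paired : ∀ {i} → Paired i → weight₀ i ≡ ½
  weight₀-paired {i} pi = cong (λ x → 1ℚ + (- ½) * x) (indicator-yes (paired? i) pi)

  phase0-bin-weight : ∀ {b} xs → Unique xs → All (λ i → i ℕ.< L × p₀ i ≡ b) xs → length xs ℕ.≤ 2 → ∑ weight₀ xs ≤ 1ℚ
  phase0-bin-weight []          _ _ _ = *≤* (ℤ.+≤+ z≤n)
  phase0-bin-weight (x ∷ [])    _ _ _ = subst (_≤ 1ℚ) (sym (+-identityʳ (weight₀ x))) (weight₀≤1 x)
  phase0-bin-weight (x ∷ y ∷ []) ((x≢y ∷ []) ∷ _) ((x<L , px) ∷ (y<L , py) ∷ []) _ =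
    ≤-reflexive (cong₂ (λ u v → u + (v + 0ℚ)) (weight₀-paired (sharing⇒Paired x<L y<L (x≢y ∘ sym) (trans py (sym px))))
                                              (weight₀-paired (sharing⇒Paired y<L x<L x≢y (trans px (sym py)))))
  phase0-bin-weight (_ ∷ _ ∷ _ ∷ _) _ _ (s≤s (s≤s ()))

  phase0-bound : ℕtoℚ L + (- ½) * C ≤ ℕtoℚ (binsUsed (phase 0) p₀)
  phase0-bound = subst (_≤ ℕtoℚ (binsUsed (phase 0) p₀)) total (∑-≤-binsUsed (L ℕ.+ 0) p₀ weight₀ bin-weight)
    where
    bin-weight : ∀ b → binWeight p₀ weight₀ (upTo (L ℕ.+ 0)) b ≤ 1ℚ
    bin-weight b = phase0-bin-weight bin (Unique-filter-upTo (λ i → p₀ i ℕ.≟ b) (L ℕ.+ 0))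
      (All.zip (phase0-bin-large p₀ b , AllP.all-filter (λ i → p₀ i ℕ.≟ b) (upTo (L ℕ.+ 0))))
      (at-most-two-large bin (phase0-bin-large p₀ b)
        (subst (_≤ 1ℚ) (load-input (L ℕ.+ 0) p₀ b) (feasible (phase 0) (phase-valid 0) b)))
      where bin = filter (λ i → p₀ i ℕ.≟ b) (upTo (L ℕ.+ 0))
    total : ∑ weight₀ (upTo (L ℕ.+ 0)) ≡ ℕtoℚ L + (- ½) * C
    total = trans (∑-linear (λ _ → 1ℚ) paired (- ½) (upTo (L ℕ.+ 0)))
      (cong (_+ (- ½) * C) (trans (∑-const {f = λ _ → 1ℚ} {xs = upTo (L ℕ.+ 0)} (All.tabulate (λ _ → refl)))
        (trans (*-identityˡ _) (cong ℕtoℚ (trans (ListP.length-upTo (L ℕ.+ 0)) L+0≡L)))))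

  weightR : ℕ → ℚ
  weightR i = size i + η * paired i

  weightR-unpaired : ∀ {i} → ¬ Paired i → weightR i ≡ size i
  weightR-unpaired {i} ¬pi = begin
    size i + η * indicator (paired? i)    ≡⟨ cong (λ x → size i + η * x) (indicator-no (paired? i) ¬pi) ⟩
    size i + η * 0ℚ                       ≡⟨ cong (_+_ (size i)) (*-zeroʳ η) ⟩
    size i + 0ℚ                           ≡⟨ +-identityʳ (size i) ⟩
    size i                                ∎
    where open ≡-Reasoning

  unpaired-bin-weight : ∀ xs → ¬ Any Paired xs → ∑ weightR xs ≡ ∑ size xs
  unpaired-bin-weight xs none = ∑-cong (All.tabulate (λ i∈ → weightR-unpaired (none ∘ lose i∈)))

  ∑-size-by-pairing : ∀ xs → ∑ size xs ≡ large * ℕtoℚ (length (filter paired? xs)) + ∑ size (filter (∁? paired?) xs)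
  ∑-size-by-pairing xs = trans (∑-partition paired? size xs)
    (cong (_+ ∑ size (filter (∁? paired?) xs)) (∑-size-large (filter paired? xs) (All.map proj₁ (AllP.all-filter paired? xs))))

  two-paired⇒only-them : ∀ {x y} xs → x ∈ xs → y ∈ xs → x ≢ y → Paired x → Paired y → ∑ size xs ≤ 1ℚ →
                         length (filter paired? xs) ≡ 2 × (∀ {z} → ¬ z ∈ filter (∁? paired?) xs)
  two-paired⇒only-them {x} {y} xs x∈ y∈ x≢y px py load≤1 = two-pairs , rest-empty
    where
    open ≤-Reasoning
    pairs = filter paired? xs
    rest  = filter (∁? paired?) xs
    pairs-load≤1 : ∑ size pairs ≤ 1ℚ
    pairs-load≤1 = ≤-trans (subst (_≤ ∑ size pairs + ∑ size rest) (+-identityʳ (∑ size pairs))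
                              (+-monoʳ-≤ (∑ size pairs) (∑-nonNeg {xs = rest} (All.tabulate (λ {i} _ → size-nonNeg i)))))
                           (subst (_≤ 1ℚ) (∑-partition paired? size xs) load≤1)
    two-pairs : length pairs ≡ 2
    two-pairs = ℕP.≤-antisym (at-most-two-large pairs (All.map proj₁ (AllP.all-filter paired? xs)) pairs-load≤1)
                             (∈∧∈∧≢⇒2≤length (∈-filter⁺ paired? x∈ px) (∈-filter⁺ paired? y∈ py) x≢y)
    rest-empty : ∀ {z} → ¬ z ∈ rest
    rest-empty {z} z∈ = <-irrefl refl (begin-strict
      1ℚ                                           <⟨ two-large+small>1 ⟩
      large * ℕtoℚ 2 + small                       ≡⟨ cong (λ n → large * ℕtoℚ n + small) two-pairs ⟨
      large * ℕtoℚ (length pairs) + small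
        ≤⟨ +-monoʳ-≤ (large * ℕtoℚ (length pairs)) (≤-trans (small≤size z) (∑-∈ z∈ (All.tabulate (λ {i} _ → size-nonNeg i)))) ⟩
      large * ℕtoℚ (length pairs) + ∑ size rest    ≡⟨ ∑-size-by-pairing xs ⟨
      ∑ size xs                                    ≤⟨ load≤1 ⟩
      1ℚ                                           ∎)

  weightR-paired : ∀ {i} → Paired i → weightR i ≡ large + η
  weightR-paired {i} pi = cong₂ _+_ (size-large (proj₁ pi)) (trans (cong (_*_ η) (indicator-yes (paired? i) pi)) (*-identityʳ η))

  paired-bin-weight : ∀ {x y} xs → x ∈ xs → y ∈ xs → x ≢ y → Paired x → Paired y → ∑ size xs ≤ 1ℚ → ∑ weightR xs ≡ 1ℚ
  paired-bin-weight xs x∈ y∈ x≢y px py load≤1 = begin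
    ∑ weightR xs                                ≡⟨ ∑-partition paired? weightR xs ⟩
    ∑ weightR pairs + ∑ weightR rest            ≡⟨ cong (_+_ (∑ weightR pairs)) (∑-empty rest rest-empty) ⟩
    ∑ weightR pairs + 0ℚ                        ≡⟨ +-identityʳ (∑ weightR pairs) ⟩
    ∑ weightR pairs                             ≡⟨ ∑-const (All.map weightR-paired (AllP.all-filter paired? xs)) ⟩
    (large + η) * ℕtoℚ (length pairs)           ≡⟨ cong (λ n → (large + η) * ℕtoℚ n) two-pairs ⟩
    (large + η) * ℕtoℚ 2                        ≡⟨ *-distribʳ-+ (ℕtoℚ 2) large η ⟩
    large * ℕtoℚ 2 + η * ℕtoℚ 2                 ≡⟨ two-large+two-η≡1 ⟩
    1ℚ                                          ∎
    where
    open ≡-Reasoning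
    pairs = filter paired? xs
    rest  = filter (∁? paired?) xs
    two-pairs = proj₁ (two-paired⇒only-them xs x∈ y∈ x≢y px py load≤1)
    rest-empty = proj₂ (two-paired⇒only-them xs x∈ y∈ x≢y px py load≤1)

  pR : ℕ → ℕ
  pR = A (phase R)

  phaseR-bin : ℕ → List ℕ
  phaseR-bin b = filter (λ i → pR i ℕ.≟ b) (upTo (L ℕ.+ R))

  phaseR-load≤1 : ∀ b → ∑ size (phaseR-bin b) ≤ 1ℚ
  phaseR-load≤1 b = subst (_≤ 1ℚ) (load-input (L ℕ.+ R) pR b) (feasible (phase R) (phase-valid R) b)

  phaseR-bin-weight : ∀ b → binWeight pR weightR (upTo (L ℕ.+ R)) b ≤ 1ℚ
  phaseR-bin-weight b = by-cases (any? paired? (phaseR-bin b))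
    where
    by-cases : Dec (Any Paired (phaseR-bin b)) → ∑ weightR (phaseR-bin b) ≤ 1ℚ
    by-cases (no  none) = subst (_≤ 1ℚ) (sym (unpaired-bin-weight (phaseR-bin b) none)) (phaseR-load≤1 b)
    by-cases (yes some) = with-pair (find some)
      where
      with-pair : (∃ λ x → x ∈ phaseR-bin b × Paired x) → ∑ weightR (phaseR-bin b) ≤ 1ℚ
      with-pair (x , x∈ , px) = ≤-reflexive (paired-bin-weight (phaseR-bin b) x∈ j∈ (j≢x ∘ sym) px pj (phaseR-load≤1 b))
        where
        open ≡-Reasoning
        j    = proj₁ (partner px)
        j≢x  = proj₁ (proj₂ (partner px))
        same = proj₁ (proj₂ (proj₂ (partner px)))
        pj   = proj₂ (proj₂ (proj₂ (partner px)))
        j∈ : j ∈ phaseR-bin b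
        j∈ = ∈-filter⁺ (λ i → pR i ℕ.≟ b) (∈-upTo⁺ (ℕP.<-≤-trans (proj₁ pj) (ℕP.m≤m+n L R))) (begin
          pR j    ≡⟨ large-fixed R (proj₁ pj) ⟩
          p₀ j    ≡⟨ same ⟩
          p₀ x    ≡⟨ large-fixed R (proj₁ px) ⟨
          pR x    ≡⟨ proj₂ (∈-filter⁻ (λ i → pR i ℕ.≟ b) {xs = upTo (L ℕ.+ R)} x∈) ⟩
          b       ∎)

  phaseR-bound : ℕtoℚ L + η * C ≤ ℕtoℚ (binsUsed (phase R) pR)
  phaseR-bound = subst (_≤ ℕtoℚ (binsUsed (phase R) pR)) total (∑-≤-binsUsed (L ℕ.+ R) pR weightR phaseR-bin-weight)
    where
    total : ∑ weightR (upTo (L ℕ.+ R)) ≡ ℕtoℚ L + η * C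
    total = trans (∑-linear size paired η (upTo (L ℕ.+ R))) (cong₂ (λ u v → u + η * v) ∑-size-phaseR
      (∑-upTo-vanishing paired L (λ r → indicator-no (paired? (L ℕ.+ r)) (ℕP.≤⇒≯ (ℕP.m≤m+n L r) ∘ proj₁)) R))

  η≤[ρ-1][1+η] : ∀ {ρ N} → 0 ℕ.< M → N ℕ.≤ M → Competitive ρ N A → η ≤ (ρ - 1ℚ) * (1ℚ + η)
  η≤[ρ-1][1+η] {ρ} {N} 0<M N≤M competitive =
    two-phase-inequality {ℕtoℚ M} {C} {η} {ρ} (ℕtoℚ-mono-< {0} {M} 0<M) (<⇒≤ η>0) first second
    where
    L≡2M : ℕtoℚ L ≡ ℕtoℚ 2 * ℕtoℚ M
    L≡2M = ℕtoℚ-* 2 M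
    first : ℕtoℚ 2 * ℕtoℚ M + (- ½) * C ≤ ρ * ℕtoℚ M
    first = subst (λ x → x + (- ½) * C ≤ ρ * ℕtoℚ M) L≡2M
              (≤-trans phase0-bound (competitive (phase 0) M (phase-valid 0) phase0-OPT N≤M))
    second : ℕtoℚ 2 * ℕtoℚ M + η * C ≤ ρ * (ℕtoℚ 2 * ℕtoℚ M)
    second = subst (λ x → x + η * C ≤ ρ * x) L≡2M
               (≤-trans phaseR-bound (competitive (phase R) L (phase-valid R) phaseR-OPT (ℕP.≤-trans N≤M (ℕP.m≤m+n M (M ℕ.+ 0)))))

corollary1 : (ε : ℚ) (ε>0 : 0ℚ < ε) (γ : ℚ) → γ ≤ migrationBound ε ε>0 →
    ¬ (Σ OnlineAlgorithm λ A → Σ (List ℚ → ℚ) λ f →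
         LittleOOPT f × GoodAlgorithm (1ℚ + ε) γ A f)
corollary1 ε ε>0 γ γ≤bound (A , f , f∈o[OPT] , feasible , ratio , migration) =
  refute (choose-t ε>0 (migration-nonNeg migration) (migrationBound⇒6εγ+11ε≤1 ε ε>0 γ γ≤bound))
  where
  refute : (∃ λ t → ℕtoℚ 5 * γ < ℕtoℚ (6 ℕ.+ 5 ℕ.* t) × ε * ℕtoℚ (9 ℕ.+ 5 ℕ.* t) < 1ℚ) → ⊥
  refute (t , 5γ<6+5t , εX<1) = no-room {ε} εX<1 η-bound
    where
    open Sizes t
    δ-pos : 0ℚ < δ ε
    δ-pos = δ>0 {ε} εX<1
    N : ℕ
    N = proj₁ (f∈o[OPT] (δ ε) δ-pos)
    competitive : Competitive (1ℚ + ε + δ ε) N A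
    competitive = asymptotic⇒competitive {1ℚ + ε} {δ ε} ratio (proj₂ (f∈o[OPT] (δ ε) δ-pos))
    η-bound : η ≤ (1ℚ + ε + δ ε - 1ℚ) * (1ℚ + η)
    η-bound = Adversary.η≤[ρ-1][1+η] t (suc N) A γ feasible migration (5γ<6+5t⇒γ*small<large {γ} 5γ<6+5t)
                {1ℚ + ε + δ ε} (s≤s z≤n) (ℕP.n≤1+n N) competitive
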